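{- Let $d\ge 2$ be a constant. There is a randomized algorithm which, given the vertex set $U(\mathcal{H})$ of a $d$-uniform hypergraph $\mathcal{H}$ (whose hyperedges are unknown), a positive integer $k$, and access to a GPISE oracle for $\mathcal{H}$, makes $\mathcal{O}(k^{2d}\log k)$ GPISE queries and, with probability at least $1-1/k^{c}$ for some constant $c>0$, solves $d$-Packing: it outputs a set of at least $k$ pairwise vertex-disjoint hyperedges of $\mathcal{H}$ if such a set exists, and otherwise reports that no such set exists.
   Context: A $d$-uniform hypergraph $\mathcal{H}$ has vertex set $U(\mathcal{H})$ and hyperedge set $\mathcal{F}(\mathcal{H})$, each hyperedge being a $d$-element subset of $U(\mathcal{H})$. The GPISE (generalized $d$-partite independent set edge) oracle takes as input $d$ pairwise disjoint non-empty subsets $A_1,\dots,A_d\subseteq U(\mathcal{H})$ and returns some hyperedge $\{u_1,\dots,u_d\}\in\mathcal{F}(\mathcal{H})$ with $u_i\in A_i$ for every $i\in[d]$ if one exists (an arbitrary such hyperedge), and returns NULL otherwise. The algorithm only counts oracle queries; running time is not bounded. -}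

module Defs where

open import Data.Nat using (ℕ; zero; suc; _+_; _*_; _∸_; _^_; _≤_)
open import Data.Nat.Logarithm using (⌊log₂_⌋)
open import Data.Bool using (Bool; true)
open import Data.Fin using (Fin)
open import Data.Fin.Subset using (Subset; _∈_; ∣_∣; Nonempty; Empty; _∩_)
open import Data.Maybe using (Maybe; just; nothing)
open import Data.List using (List; length)
open import Data.List.Relation.Unary.All using (All)
open import Data.List.Relation.Unary.AllPairs using (AllPairs)
open import Data.Product using (Σ; ∃; _×_; _,_)
open import Data.Unit using (⊤)
open import Relation.Nullary using (¬_)
open import Relation.Binary.PropositionalEquality using (_≡_; _≢_)

-- A d-uniform hypergraph on vertex set U(H) = Fin n.
-- Hyperedges are subsets of Fin n; `edge e ≡ true` means e ∈ F(H).
record Hypergraph (d n : ℕ) : Set where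
  field
    edge    : Subset n → Bool
    uniform : ∀ e → edge e ≡ true → ∣ e ∣ ≡ d

IsEdge : ∀ {d n} → Hypergraph d n → Subset n → Set
IsEdge H e = Hypergraph.edge H e ≡ true

Query : ℕ → ℕ → Set
Query d n = Fin d → Subset n

ValidQuery : ∀ {d n} → Query d n → Set
ValidQuery {d} A = (∀ i → Nonempty (A i)) × (∀ (i j : Fin d) → i ≢ j → Empty (A i ∩ A j))

Crosses : ∀ {d n} → Query d n → Subset n → Set
Crosses {d} {n} A e =
  Σ (Fin d → Fin n) λ u →
    (∀ i → u i ∈ A i) × (∀ x → (x ∈ e → ∃ λ i → u i ≡ x) × ((∃ λ i → u i ≡ x) → x ∈ e))

record GPISE {d n : ℕ} (H : Hypergraph d n) : Set where
  field
    answer   : Query d n → Maybe (Subset n)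
    sound    : ∀ A → ValidQuery A → ∀ e → answer A ≡ just e → IsEdge H e × Crosses A e
    complete : ∀ A → ValidQuery A → answer A ≡ nothing → ∀ e → IsEdge H e → ¬ Crosses A e

-- Deterministic adaptive query algorithms (decision trees) with output type Out.
data Alg (d n : ℕ) (Out : Set) : Set where
  ret : Out → Alg d n Out
  ask : Query d n → (Maybe (Subset n) → Alg d n Out) → Alg d n Out

module _ {d n : ℕ} {Out : Set} (O : Query d n → Maybe (Subset n)) where
  run : Alg d n Out → Out
  run (ret x)   = x
  run (ask q f) = run (f (O q))

  queries : Alg d n Out → ℕ
  queries (ret _)   = 0
  queries (ask q f) = suc (queries (f (O q)))

  ValidRun : Alg d n Out → Set
  ValidRun (ret _)   = ⊤
  ValidRun (ask q f) = ValidQuery q × ValidRun (f (O q))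

Packing : ∀ {d n} → Hypergraph d n → List (Subset n) → Set
Packing H S = All (IsEdge H) S × AllPairs (λ e f → Empty (e ∩ f)) S

PackOut : ℕ → Set
PackOut n = Maybe (List (Subset n))

SolvesPacking : ∀ {d n} → Hypergraph d n → ℕ → PackOut n → Set
SolvesPacking H k (just S) = Packing H S × k ≤ length S
SolvesPacking H k nothing  = ¬ (Σ _ λ S → Packing H S × k ≤ length S)

-- A randomized query algorithm for d-uniform hypergraphs: on input (n, k)
-- (vertex set Fin n and the parameter k) it draws a uniformly random seed
-- from Fin R (R ≥ 1 chosen depending on n, k) and then runs a deterministic
-- adaptive query algorithm.
record RandAlg (d : ℕ) : Set where
  field
    seeds : ℕ → ℕ → ℕ
    seeds-pos : ∀ n k → 1 ≤ seeds n k
    tree  : ∀ n k → Fin (seeds n k) → Alg d n (PackOut n)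

-- With m = 1 + 2(kd)² colours and T = 1 + ⌊log₂ k⌋ rounds, a random seed is a sequence of T
-- colourings h : U(H) → [m]. For every round and every colour pattern c ∈ [m]^d the algorithm
-- asks the class query (h⁻¹(c 1), …, h⁻¹(c d)) if it is admissible — T·m^d ≤ (3d²)^d k^(2d) T
-- queries — and then searches the answers exhaustively for k pairwise disjoint hyperedges.
-- Answers are hyperedges, so a reported packing is always correct, and so is "none" when no
-- k-packing exists. If a k-packing P exists and a colouring is injective on its kd vertices,
-- the class queries for the colour patterns of the edges of P are answered by hyperedges with
-- pairwise different colour sets, hence pairwise disjoint. By the union bound over pairs of
-- vertices (each pair collides with probability 1/m) a colouring fails with probability
-- (kd)²/m < 1/2, so all T rounds fail with probability below 2^-T < 1/k.
module Submission where

open import Defs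
open import Data.Bool using (Bool; true; false; not; _∧_; _∨_)
import Data.Bool.Properties as Bool
open import Data.Fin using (Fin; zero; suc; quotient; remainder; combine; finToFun; funToFin; inject≤)
  renaming (_<_ to _<ᶠ_)
import Data.Fin.Properties as Fin
open import Data.Fin.Properties
  using (all?; remQuot-combine; combine-remQuot; combine-injective; finToFun-funToFin)
open import Data.Fin.Subset using (Subset; _∈_; ∣_∣; Empty; _∩_; ⊤)
open import Data.Fin.Subset.Properties using (x∈p∩q⁺; x∈p∩q⁻; nonempty?; anySubset?; ∣⊤∣≡n)
open import Data.List using (List; []; _∷_; length)
import Data.List as List
import Data.List.Properties as List
open import Data.List.Membership.Propositional using () renaming (_∈_ to _∈ₗ_)
open import Data.List.Membership.Propositional.Properties
  using (∈-lookup; ∈-map⁺; ∈-map⁻; ∈-filter⁺; ∈-tabulate⁺)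
open import Data.List.Relation.Unary.All using (All; []; _∷_)
import Data.List.Relation.Unary.All as All
import Data.List.Relation.Unary.All.Properties as All
open import Data.List.Relation.Unary.AllPairs using (AllPairs; _∷_)
import Data.List.Relation.Unary.AllPairs.Properties as AllPairs
open import Data.Maybe using (Maybe; just; nothing)
import Data.Maybe.Properties as Maybe
open import Data.Nat using (ℕ; zero; suc; _+_; _*_; _∸_; _^_; _≤_; _<_; z≤n; s≤s; >-nonZero)
open import Data.Nat.Properties
  using ( +-assoc; +-suc; +-identityʳ; *-comm; *-assoc; *-zeroʳ; *-identityʳ; ^-*-assoc
        ; ≤-refl; ≤-reflexive; ≤-trans; <⇒≤; n≤1+n; _≤?_; ≰⇒>; <-irrefl
        ; m+n∸m≡n; n∸n≡0; m^n>0; m^n≢0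
        ; +-mono-≤; +-monoˡ-≤; *-mono-≤; *-monoˡ-≤; *-monoʳ-≤; *-cancelˡ-≤; ^-monoˡ-≤
        ; +-*-semiring; module ≤-Reasoning)
open import Algebra.Properties.Semiring.Sum +-*-semiring
  using (sum; sum-syntax; sum-cong-≗; ∑-comm; *-distribˡ-sum; *-distribʳ-sum)
open import Data.Nat.Logarithm using (⌊log₂_⌋; ⌊log₂⌋-mono-≤; ⌊log₂[2^n]⌋≡n)
open import Data.Nat.Tactic.RingSolver using (solve-∀)
open import Data.Product using (Σ; ∃; _×_; _,_; proj₁; proj₂; swap)
import Data.Product as Product
open import Data.Sum using (_⊎_; inj₁; inj₂)
open import Data.Unit using (tt)
open import Data.Vec using (Vec; []; _∷_; here; there)
import Data.Vec as Vec
open import Data.Vec.Properties using (lookup∘tabulate)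
import Data.Vec.Properties as Vec
open import Data.Vec.Functional using (Vector; _++_; concat; foldr)
open import Function using (_∘_)
open import Function.Definitions using (Injective)
open import Relation.Binary.Definitions using (tri<; tri≈; tri>)
open import Relation.Binary.PropositionalEquality
open import Relation.Nullary using (¬_; Dec; yes; no; does; contradiction)
open import Relation.Nullary.Decidable using (dec-true; map′; ¬?; _×-dec_; _→-dec_)
open import Relation.Unary using (Decidable)

∑-mono : ∀ {N} {f g : Vector ℕ N} → (∀ i → f i ≤ g i) → sum f ≤ sum g
∑-mono {zero}  f≤g = z≤n
∑-mono {suc N} f≤g = +-mono-≤ (f≤g zero) (∑-mono (f≤g ∘ suc))

∑-const : ∀ N c → ∑[ i < N ] c ≡ N * c
∑-const zero    c = refl
∑-const (suc N) c = cong (c +_) (∑-const N c)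

sum-++ : ∀ {M N} (f : Vector ℕ M) (g : Vector ℕ N) → sum (f ++ g) ≡ sum f + sum g
sum-++ {zero}  f g = refl
sum-++ {suc M} f g =
  trans (cong (f zero +_) (trans (sum-cong-≗ tail-++) (sum-++ (f ∘ suc) g))) (sym (+-assoc (f zero) _ _))
  where
  tail-++ : ∀ i → (f ++ g) (suc i) ≡ ((f ∘ suc) ++ g) i
  tail-++ i with Data.Fin.splitAt M i
  ... | inj₁ _ = refl
  ... | inj₂ _ = refl

sum-concat : ∀ {M N} (f : Vector (Vector ℕ N) M) → sum (concat f) ≡ ∑[ i < M ] sum (f i)
sum-concat {zero}      f = refl
sum-concat {suc M} {N} f = begin
  sum (concat f)                       ≡⟨ sum-cong-≗ blocks ⟩
  sum (f zero ++ concat (f ∘ suc))     ≡⟨ sum-++ (f zero) _ ⟩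
  sum (f zero) + sum (concat (f ∘ suc)) ≡⟨ cong (sum (f zero) +_) (sum-concat (f ∘ suc)) ⟩
  ∑[ i < suc M ] sum (f i)             ∎
  where
  open ≡-Reasoning
  blocks : ∀ i → concat f i ≡ (f zero ++ concat (f ∘ suc)) i
  blocks i with Data.Fin.splitAt N i
  ... | inj₁ _ = refl
  ... | inj₂ _ = refl

*-∑-comm : ∀ m {R A} (F : Fin R → Fin A → ℕ) →
  m * ∑[ r < R ] ∑[ a < A ] F r a ≡ ∑[ a < A ] (m * ∑[ r < R ] F r a)
*-∑-comm m {R} {A} F = trans (cong (m *_) (∑-comm F)) (*-distribˡ-sum {A} m (λ a → ∑[ r < R ] F r a))

𝟙 : Bool → ℕ
𝟙 true  = 1
𝟙 false = 0

𝟙-∧ : ∀ a b → 𝟙 (a ∧ b) ≡ 𝟙 a * 𝟙 b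
𝟙-∧ true  b = sym (+-identityʳ (𝟙 b))
𝟙-∧ false b = refl

anyᵇ allᵇ : ∀ {N} → Vector Bool N → Bool
anyᵇ = foldr _∨_ false
allᵇ = foldr _∧_ true

𝟙-anyᵇ≤∑ : ∀ {N} (f : Vector Bool N) → 𝟙 (anyᵇ f) ≤ ∑[ i < N ] 𝟙 (f i)
𝟙-anyᵇ≤∑ {zero}  f = z≤n
𝟙-anyᵇ≤∑ {suc N} f with f zero
... | true  = s≤s z≤n
... | false = 𝟙-anyᵇ≤∑ (f ∘ suc)

anyᵇ-false : ∀ {N} (f : Vector Bool N) → anyᵇ f ≡ false → ∀ i → f i ≡ false
anyᵇ-false {suc N} f none i with f zero in f₀
anyᵇ-false f none zero    | false = f₀
anyᵇ-false f none (suc i) | false = anyᵇ-false (f ∘ suc) none i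

allᵇ-false : ∀ {N} (f : Vector Bool N) → allᵇ f ≡ false → ∃ λ i → f i ≡ false
allᵇ-false {suc N} f notAll with f zero in f₀
... | false = zero , f₀
... | true  with allᵇ-false (f ∘ suc) notAll
...   | i , fᵢ = suc i , fᵢ

_≡ᵇ_ : ∀ {m} → Fin m → Fin m → Bool
x ≡ᵇ y = does (x Fin.≟ y)

≡ᵇ⇒≡ : ∀ {m} {x y : Fin m} → x ≡ᵇ y ≡ true → x ≡ y
≡ᵇ⇒≡ {x = x} {y} x≡ᵇy with x Fin.≟ y
... | yes x≡y = x≡y

≡⇒≡ᵇ : ∀ {m} {x y : Fin m} → x ≡ y → x ≡ᵇ y ≡ true
≡⇒≡ᵇ {x = x} {y} = dec-true (x Fin.≟ y)

≡ᵇ-sym : ∀ {m} (x y : Fin m) → x ≡ᵇ y ≡ y ≡ᵇ x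
≡ᵇ-sym x y with x Fin.≟ y | y Fin.≟ x
... | yes _   | yes _   = refl
... | no  _   | no  _   = refl
... | yes x≡y | no  y≢x = contradiction (sym x≡y) y≢x
... | no  x≢y | yes y≡x = contradiction (sym y≡x) x≢y

∑-≡ᵇ : ∀ {m} (y : Fin m) → ∑[ c < m ] 𝟙 (c ≡ᵇ y) ≡ 1
∑-≡ᵇ {suc m} zero    = cong suc (trans (∑-const m 0) (*-zeroʳ m))
∑-≡ᵇ {suc m} (suc y) = ∑-≡ᵇ y

∣tabulate∣ : ∀ {R} (g : Fin R → Bool) → ∣ Vec.tabulate g ∣ + ∑[ r < R ] 𝟙 (not (g r)) ≡ R
∣tabulate∣ {zero}  g = refl
∣tabulate∣ {suc R} g with g zero | ∣tabulate∣ (g ∘ suc)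
... | true  | count = cong suc count
... | false | count = trans (+-suc _ _) (cong suc count)

∸∣tabulate∣ : ∀ {R} (g : Fin R → Bool) → R ∸ ∣ Vec.tabulate g ∣ ≡ ∑[ r < R ] 𝟙 (not (g r))
∸∣tabulate∣ {R} g =
  trans (cong (_∸ ∣ Vec.tabulate g ∣) (sym (∣tabulate∣ g))) (m+n∸m≡n ∣ Vec.tabulate g ∣ _)

∈-tabulate⁻ : ∀ {R} {g : Fin R → Bool} {r} → r ∈ Vec.tabulate g → g r ≡ true
∈-tabulate⁻ {g = g} {r} r∈ = trans (sym (lookup∘tabulate g r)) (Vec.[]=⇒lookup r∈)

-- Random functions. An index r : Fin (m ^ n) encodes the function decode m n r : Fin n → Fin m,
-- so sums over Fin (m ^ n) are sums over all functions Fin n → Fin m.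
decode : ∀ m n → Fin (m ^ n) → Fin n → Fin m
decode m n = finToFun

-- A function on Fin (suc n) is its value at zero together with its restriction to the successors.
∑-decode : ∀ {m n} (G : Fin m → (Fin n → Fin m) → ℕ) →
  ∑[ r < m ^ suc n ] G (decode m (suc n) r zero) (decode m (suc n) r ∘ suc)
    ≡ ∑[ c < m ] ∑[ r < m ^ n ] G c (decode m n r)
∑-decode {m} {n} G = sum-concat (λ c r → G c (decode m n r))

-- A random function Fin n → Fin m identifies two distinct points with probability 1/m.
collision : ∀ m {n} {x y : Fin n} → x ≢ y →
  m * ∑[ r < m ^ n ] 𝟙 (decode m n r x ≡ᵇ decode m n r y) ≡ m ^ n
collision m {suc n} {zero}  {zero}  x≢y = contradiction refl x≢y
collision m {suc n} {zero}  {suc y} _   = cong (m *_) (begin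
  ∑[ r < m ^ suc n ] 𝟙 (decode m (suc n) r zero ≡ᵇ decode m (suc n) r (suc y))
    ≡⟨ ∑-decode {m} {n} (λ c g → 𝟙 (c ≡ᵇ g y)) ⟩
  ∑[ c < m ] ∑[ r < m ^ n ] 𝟙 (c ≡ᵇ decode m n r y)
    ≡⟨ ∑-comm (λ c r → 𝟙 (c ≡ᵇ decode m n r y)) ⟩
  ∑[ r < m ^ n ] ∑[ c < m ] 𝟙 (c ≡ᵇ decode m n r y)
    ≡⟨ sum-cong-≗ (λ r → ∑-≡ᵇ (decode m n r y)) ⟩
  ∑[ r < m ^ n ] 1
    ≡⟨ trans (∑-const (m ^ n) 1) (*-identityʳ (m ^ n)) ⟩
  m ^ n ∎)
  where open ≡-Reasoning
collision m {suc n} {suc x} {zero}  x≢y =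
  trans (cong (m *_) (sum-cong-≗ {m ^ suc n} λ r → cong 𝟙 (≡ᵇ-sym (g r (suc x)) (g r zero))))
        (collision m {suc n} {zero} {suc x} (x≢y ∘ sym))
  where
  g : Fin (m ^ suc n) → Fin (suc n) → Fin m
  g = decode m (suc n)
collision m {suc n} {suc x} {suc y} x≢y = cong (m *_) (begin
  ∑[ r < m ^ suc n ] 𝟙 (decode m (suc n) r (suc x) ≡ᵇ decode m (suc n) r (suc y))
    ≡⟨ ∑-decode {m} {n} (λ _ g → 𝟙 (g x ≡ᵇ g y)) ⟩
  ∑[ c < m ] ∑[ r < m ^ n ] 𝟙 (decode m n r x ≡ᵇ decode m n r y)
    ≡⟨ ∑-const m _ ⟩
  m * ∑[ r < m ^ n ] 𝟙 (decode m n r x ≡ᵇ decode m n r y)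
    ≡⟨ collision m (x≢y ∘ cong suc) ⟩
  m ^ n ∎)
  where open ≡-Reasoning

-- The probability that T independent samples from Fin M all satisfy B is the T-th power
-- of the probability for one sample.
∑-allᵇ : ∀ {M} T (B : Fin M → Bool) →
  ∑[ r < M ^ T ] 𝟙 (allᵇ (B ∘ decode M T r)) ≡ (∑[ s < M ] 𝟙 (B s)) ^ T
∑-allᵇ zero    B = refl
∑-allᵇ {M} (suc T) B = begin
  ∑[ r < M ^ suc T ] 𝟙 (allᵇ (B ∘ decode M (suc T) r))
    ≡⟨ ∑-decode {M} {T} (λ c g → 𝟙 (B c ∧ allᵇ (B ∘ g))) ⟩
  ∑[ c < M ] ∑[ r < M ^ T ] 𝟙 (B c ∧ allᵇ (B ∘ decode M T r))
    ≡⟨ sum-cong-≗ (λ c → sum-cong-≗ (λ r → 𝟙-∧ (B c) (allᵇ (B ∘ decode M T r)))) ⟩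
  ∑[ c < M ] ∑[ r < M ^ T ] (𝟙 (B c) * 𝟙 (allᵇ (B ∘ decode M T r)))
    ≡⟨ sum-cong-≗ (λ c → sym (*-distribˡ-sum (𝟙 (B c)) (λ r → 𝟙 (allᵇ (B ∘ decode M T r))))) ⟩
  ∑[ c < M ] (𝟙 (B c) * ∑[ r < M ^ T ] 𝟙 (allᵇ (B ∘ decode M T r)))
    ≡⟨ sum-cong-≗ (λ c → cong (𝟙 (B c) *_) (∑-allᵇ {M} T B)) ⟩
  ∑[ c < M ] (𝟙 (B c) * b ^ T)
    ≡⟨ sym (*-distribʳ-sum (b ^ T) (λ c → 𝟙 (B c))) ⟩
  b * b ^ T ∎
  where
  open ≡-Reasoning
  b : ℕ
  b = ∑[ s < M ] 𝟙 (B s)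

module Colouring {N n : ℕ} (w : Fin N → Fin n) (w-injective : Injective _≡_ _≡_ w) where

  clash : ∀ {m} → (Fin n → Fin m) → Fin N → Fin N → Bool
  clash h a b = not (a ≡ᵇ b) ∧ (h (w a) ≡ᵇ h (w b))

  bad : ∀ {m} → (Fin n → Fin m) → Bool
  bad h = anyᵇ λ a → anyᵇ λ b → clash h a b

  good⇒injective : ∀ {m} (h : Fin n → Fin m) → bad h ≡ false → Injective _≡_ _≡_ (h ∘ w)
  good⇒injective h good {a} {b} same = distinct-colours (anyᵇ-false _ (anyᵇ-false _ good a) b)
    where
    distinct-colours : clash h a b ≡ false → a ≡ b
    distinct-colours noClash with a Fin.≟ b
    ... | yes a≡b = a≡b
    ... | no  _   = contradiction (trans (sym noClash) (≡⇒≡ᵇ same)) λ ()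

  clash-count : ∀ m a b → m * ∑[ r < m ^ n ] 𝟙 (clash (decode m n r) a b) ≤ m ^ n
  clash-count m a b with a Fin.≟ b
  ... | yes _   = ≤-trans (≤-reflexive no-clash) z≤n
    where
    no-clash : m * ∑[ r < m ^ n ] 0 ≡ 0
    no-clash = trans (cong (m *_) (trans (∑-const (m ^ n) 0) (*-zeroʳ (m ^ n)))) (*-zeroʳ m)
  ... | no  a≢b = ≤-reflexive (collision m (a≢b ∘ w-injective))

  -- Union bound over the N² pairs: at most an N²/m fraction of all colourings is bad.
  bad-count : ∀ m → m * ∑[ r < m ^ n ] 𝟙 (bad (decode m n r)) ≤ N * (N * m ^ n)
  bad-count m = begin
    m * ∑[ r < m ^ n ] 𝟙 (bad (h r))
      ≤⟨ *-monoʳ-≤ m (∑-mono λ r → union-bound (h r)) ⟩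
    m * ∑[ r < m ^ n ] ∑[ a < N ] ∑[ b < N ] 𝟙 (clash (h r) a b)
      ≡⟨ *-∑-comm m (λ r a → ∑[ b < N ] 𝟙 (clash (h r) a b)) ⟩
    ∑[ a < N ] (m * ∑[ r < m ^ n ] ∑[ b < N ] 𝟙 (clash (h r) a b))
      ≡⟨ sum-cong-≗ (λ a → *-∑-comm m (λ r b → 𝟙 (clash (h r) a b))) ⟩
    ∑[ a < N ] ∑[ b < N ] (m * ∑[ r < m ^ n ] 𝟙 (clash (h r) a b))
      ≤⟨ ∑-mono (λ a → ∑-mono (λ b → clash-count m a b)) ⟩
    ∑[ a < N ] ∑[ b < N ] (m ^ n)
      ≡⟨ trans (sum-cong-≗ {N} (λ _ → ∑-const N (m ^ n))) (∑-const N (N * m ^ n)) ⟩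
    N * (N * m ^ n) ∎
    where
    open ≤-Reasoning
    h : Fin (m ^ n) → Fin n → Fin m
    h = decode m n
    union-bound : ∀ h → 𝟙 (bad h) ≤ ∑[ a < N ] ∑[ b < N ] 𝟙 (clash h a b)
    union-bound h = ≤-trans (𝟙-anyᵇ≤∑ {N} _) (∑-mono {N} λ a → 𝟙-anyᵇ≤∑ {N} (clash h a))

^-distribʳ-* : ∀ a b e → (a * b) ^ e ≡ a ^ e * b ^ e
^-distribʳ-* a b zero    = refl
^-distribʳ-* a b (suc e) = trans (cong (a * b *_) (^-distribʳ-* a b e)) (interchange a b (a ^ e) (b ^ e))
  where
  interchange : ∀ a b x y → a * b * (x * y) ≡ a * x * (b * y)
  interchange = solve-∀

half-bad : ∀ {N b M} → 1 ≤ N → suc (2 * (N * N)) * b ≤ N * (N * M) → b * 2 ≤ M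
half-bad {N} {b} {M} 1≤N bound = *-cancelˡ-≤ (N * N) {{>-nonZero (*-mono-≤ 1≤N 1≤N)}} (begin
  N * N * (b * 2)          ≡⟨ rearrange N b ⟩
  2 * (N * N) * b          ≤⟨ *-monoˡ-≤ b (n≤1+n (2 * (N * N))) ⟩
  suc (2 * (N * N)) * b    ≤⟨ bound ⟩
  N * (N * M)              ≡⟨ *-assoc N N M ⟨
  N * N * M                ∎)
  where
  open ≤-Reasoning
  rearrange : ∀ N b → N * N * (b * 2) ≡ 2 * (N * N) * b
  rearrange = solve-∀

amplify : ∀ {b M} T k → b * 2 ≤ M → k < 2 ^ T → b ^ T * k ≤ M ^ T
amplify {b} {M} T k half k<2^T = begin
  b ^ T * k        ≤⟨ *-monoʳ-≤ (b ^ T) (<⇒≤ k<2^T) ⟩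
  b ^ T * 2 ^ T    ≡⟨ ^-distribʳ-* b 2 T ⟨
  (b * 2) ^ T      ≤⟨ ^-monoˡ-≤ T half ⟩
  M ^ T            ∎
  where open ≤-Reasoning

-- T = 1 + ⌊log₂ k⌋ rounds suffice for failure probability 2^-T < 1/k.
k<2^[1+⌊log₂k⌋] : ∀ k → k < 2 ^ suc ⌊log₂ k ⌋
k<2^[1+⌊log₂k⌋] k with 2 ^ suc ⌊log₂ k ⌋ ≤? k
... | no  2^T≰k = ≰⇒> 2^T≰k
... | yes 2^T≤k = contradiction
  (subst (_≤ ⌊log₂ k ⌋) (⌊log₂[2^n]⌋≡n (suc ⌊log₂ k ⌋)) (⌊log₂⌋-mono-≤ 2^T≤k)) (<-irrefl refl)

patterns-bound : ∀ d k → 1 ≤ k → 1 ≤ d → suc (2 * (k * d * (k * d))) ^ d ≤ (3 * d * d) ^ d * k ^ (2 * d)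
patterns-bound d k 1≤k 1≤d = begin
  suc (2 * (N * N)) ^ d              ≤⟨ ^-monoˡ-≤ d (+-monoˡ-≤ (2 * (N * N)) (*-mono-≤ 1≤N 1≤N)) ⟩
  (N * N + 2 * (N * N)) ^ d          ≡⟨ cong (_^ d) (rearrange k d) ⟩
  (3 * d * d * (k * k)) ^ d          ≡⟨ ^-distribʳ-* (3 * d * d) (k * k) d ⟩
  (3 * d * d) ^ d * (k * k) ^ d      ≡⟨ cong (λ x → (3 * d * d) ^ d * x ^ d) (cong (k *_) (*-identityʳ k)) ⟨
  (3 * d * d) ^ d * (k ^ 2) ^ d      ≡⟨ cong ((3 * d * d) ^ d *_) (^-*-assoc k 2 d) ⟩
  (3 * d * d) ^ d * k ^ (2 * d)      ∎
  where
  open ≤-Reasoning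
  N : ℕ
  N = k * d
  1≤N : 1 ≤ N
  1≤N = *-mono-≤ 1≤k 1≤d
  rearrange : ∀ k d → k * d * (k * d) + 2 * (k * d * (k * d)) ≡ 3 * d * d * (k * k)
  rearrange = solve-∀

Disjoint : ∀ {n} → Subset n → Subset n → Set
Disjoint e f = Empty (e ∩ f)

Disjoint-sym : ∀ {n} {e f : Subset n} → Disjoint e f → Disjoint f e
Disjoint-sym {e = e} {f} e∩f=∅ (x , x∈f∩e) = e∩f=∅ (x , x∈p∩q⁺ (swap (x∈p∩q⁻ f e x∈f∩e)))

-- Packings in indexed form: k pairwise disjoint sets, each satisfying P (hyperedges of H,
-- or hyperedges among the oracle answers).
record KPacking {n} (P : Subset n → Set) (k : ℕ) : Set where
  constructor packing
  field
    edge     : Fin k → Subset n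
    valid    : ∀ j → P (edge j)
    disjoint : ∀ {j j'} → j ≢ j' → Disjoint (edge j) (edge j')

  asList : List (Subset n)
  asList = List.tabulate edge

open KPacking

weaken : ∀ {n k} {P Q : Subset n → Set} → (∀ {e} → P e → Q e) → KPacking P k → KPacking Q k
weaken P⇒Q p = packing (edge p) (P⇒Q ∘ valid p) (disjoint p)

anyVec? : ∀ {n} k {P : Vec (Subset n) k → Set} → Decidable P → Dec (∃ P)
anyVec? zero    P? = map′ ([] ,_) (λ { ([] , p) → p }) (P? [])
anyVec? (suc k) P? = map′ (λ { (e , v , p) → e ∷ v , p }) (λ { (e ∷ v , p) → e , v , p })
  (anySubset? λ e → anyVec? k (λ v → P? (e ∷ v)))

kPacking? : ∀ {n} {P : Subset n → Set} → Decidable P → ∀ k → Dec (KPacking P k)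
kPacking? {n} {P} P? k = map′ fromVec toVec (anyVec? k candidate?)
  where
  Candidate : Vec (Subset n) k → Set
  Candidate v = (∀ j → P (Vec.lookup v j)) × (∀ j j' → j ≢ j' → Disjoint (Vec.lookup v j) (Vec.lookup v j'))
  candidate? : Decidable Candidate
  candidate? v = all? (λ j → P? (Vec.lookup v j)) ×-dec
    all? (λ j → all? λ j' → ¬? (j Fin.≟ j') →-dec ¬? (nonempty? (Vec.lookup v j ∩ Vec.lookup v j')))
  fromVec : ∃ Candidate → KPacking P k
  fromVec (v , ok , dj) = packing (Vec.lookup v) ok (dj _ _)
  toVec : KPacking P k → ∃ Candidate
  toVec p = Vec.tabulate (edge p)
          , (λ j → subst P (sym (lookup∘tabulate (edge p) j)) (valid p j))
          , λ j j' j≢j' → subst₂ Disjoint (sym (lookup∘tabulate (edge p) j)) (sym (lookup∘tabulate (edge p) j'))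
                                    (disjoint p j≢j')

asList-solves : ∀ {d n k} {H : Hypergraph d n} (p : KPacking (IsEdge H) k) → SolvesPacking H k (just (asList p))
asList-solves p = (All.tabulate⁺ (valid p) , AllPairs.tabulate⁺ (disjoint p))
                , ≤-reflexive (sym (List.length-tabulate (edge p)))

AllPairs-lookup-< : ∀ {n} {S : List (Subset n)} → AllPairs Disjoint S →
  ∀ {i j} → i <ᶠ j → Disjoint (List.lookup S i) (List.lookup S j)
AllPairs-lookup-< (S₀ ∷ _)   {zero}  {suc j} _         = All.lookup S₀ (∈-lookup j)
AllPairs-lookup-< (_ ∷ rest) {suc i} {suc j} (s≤s i<j) = AllPairs-lookup-< rest i<j

AllPairs-lookup-≢ : ∀ {n} {S : List (Subset n)} → AllPairs Disjoint S →
  ∀ {i j} → i ≢ j → Disjoint (List.lookup S i) (List.lookup S j)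
AllPairs-lookup-≢ pairs {i} {j} i≢j with Fin.<-cmp i j
... | tri< i<j _ _ = AllPairs-lookup-< pairs i<j
... | tri≈ _ i≡j _ = contradiction i≡j i≢j
... | tri> _ _ j<i = Disjoint-sym (AllPairs-lookup-< pairs j<i)

fromList : ∀ {d n k} {H : Hypergraph d n} {S} → Packing H S → k ≤ length S → KPacking (IsEdge H) k
fromList {S = S} (edges , pairs) k≤∣S∣ = packing
  (λ j → List.lookup S (inject≤ j k≤∣S∣))
  (λ j → All.lookup edges (∈-lookup _))
  (λ j≢j' → AllPairs-lookup-≢ pairs (j≢j' ∘ Fin.inject≤-injective k≤∣S∣ k≤∣S∣ _ _))

Answered : ∀ {n} → List (Maybe (Subset n)) → Subset n → Set
Answered L e = just e ∈ₗ L

answered? : ∀ {n} (L : List (Maybe (Subset n))) → Decidable (Answered L)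
answered? L e = just e ∈? L
  where open import Data.List.Membership.DecPropositional (Maybe.≡-dec (Vec.≡-dec Bool._≟_)) using (_∈?_)

decidePacking : ∀ {n} k → List (Maybe (Subset n)) → PackOut n
decidePacking k L with kPacking? (answered? L) k
... | yes p = just (asList p)
... | no  _ = nothing

decidePacking-correct : ∀ {d n} (H : Hypergraph d n) k L → (∀ {e} → Answered L e → IsEdge H e) →
  ¬ KPacking (IsEdge H) k ⊎ KPacking (Answered L) k → SolvesPacking H k (decidePacking k L)
decidePacking-correct H k L answers-are-edges alternative with kPacking? (answered? L) k | alternative
... | yes p     | _          = asList-solves {H = H} (weaken answers-are-edges p)
... | no  _     | inj₁ none  = λ (S , pack , k≤∣S∣) → none (fromList {H = H} pack k≤∣S∣)
... | no ¬found | inj₂ found = contradiction found ¬found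

nonAdaptive : ∀ {d n} {Out : Set} → List (Query d n) → (List (Maybe (Subset n)) → Out) → Alg d n Out
nonAdaptive []       f = ret (f [])
nonAdaptive (q ∷ qs) f = ask q λ a → nonAdaptive qs (f ∘ (a ∷_))

module _ {d n} {Out : Set} (O : Query d n → Maybe (Subset n)) where

  run-nonAdaptive : ∀ qs (f : List (Maybe (Subset n)) → Out) → run O (nonAdaptive qs f) ≡ f (List.map O qs)
  run-nonAdaptive []       f = refl
  run-nonAdaptive (q ∷ qs) f = run-nonAdaptive qs (f ∘ (O q ∷_))

  queries-nonAdaptive : ∀ qs (f : List (Maybe (Subset n)) → Out) → queries O (nonAdaptive qs f) ≡ length qs
  queries-nonAdaptive []       f = refl
  queries-nonAdaptive (q ∷ qs) f = cong suc (queries-nonAdaptive qs (f ∘ (O q ∷_)))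

  valid-nonAdaptive : ∀ {qs} (f : List (Maybe (Subset n)) → Out) → All ValidQuery qs → ValidRun O (nonAdaptive qs f)
  valid-nonAdaptive f []         = tt
  valid-nonAdaptive f (v ∷ vs) = v , valid-nonAdaptive _ vs

record Enumeration {n} (e : Subset n) (d : ℕ) : Set where
  field
    point     : Fin d → Fin n
    injective : Injective _≡_ _≡_ point
    member    : ∀ i → point i ∈ e
    onto      : ∀ {x} → x ∈ e → ∃ λ i → point i ≡ x

enumerate : ∀ {n} (e : Subset n) → Enumeration e ∣ e ∣
enumerate []          = record { point = λ () ; injective = λ { {()} } ; member = λ () ; onto = λ () }
enumerate (false ∷ e) = record
  { point     = suc ∘ point
  ; injective = injective ∘ Fin.suc-injective
  ; member    = there ∘ member
  ; onto      = λ { (there x∈e) → Product.map₂ (cong suc) (onto x∈e) }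
  }
  where open Enumeration (enumerate e)
enumerate (true ∷ e) = record { point = point′ ; injective = injective′ ; member = member′ ; onto = onto′ }
  where
  open Enumeration (enumerate e)
  point′ : Fin (suc ∣ e ∣) → Fin (suc _)
  point′ zero    = zero
  point′ (suc i) = suc (point i)
  injective′ : Injective _≡_ _≡_ point′
  injective′ {zero}  {zero}  _    = refl
  injective′ {suc i} {suc j} same = cong suc (injective (Fin.suc-injective same))
  member′ : ∀ i → point′ i ∈ (true ∷ e)
  member′ zero    = here
  member′ (suc i) = there (member i)
  onto′ : ∀ {x} → x ∈ (true ∷ e) → ∃ λ i → point′ i ≡ x
  onto′ here        = zero , refl
  onto′ (there x∈e) = Product.map suc (cong suc) (onto x∈e)

classQuery : ∀ {d n m} → (Fin n → Fin m) → (Fin d → Fin m) → Query d n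
classQuery h c i = Vec.tabulate (λ x → h x ≡ᵇ c i)

module _ {d n m} (h : Fin n → Fin m) (c : Fin d → Fin m) {x : Fin n} {i : Fin d} where

  ∈-classQuery⁻ : x ∈ classQuery h c i → h x ≡ c i
  ∈-classQuery⁻ x∈ = ≡ᵇ⇒≡ (trans (sym (lookup∘tabulate _ x)) (Vec.[]=⇒lookup x∈))

  ∈-classQuery⁺ : h x ≡ c i → x ∈ classQuery h c i
  ∈-classQuery⁺ same = Vec.lookup⇒[]= x _ (trans (lookup∘tabulate _ x) (≡⇒≡ᵇ same))

valid? : ∀ {d n} → Decidable (ValidQuery {d} {n})
valid? A = all? (λ i → nonempty? (A i))
     ×-dec all? λ i → all? λ j → ¬? (i Fin.≟ j) →-dec ¬? (nonempty? (A i ∩ A j))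

module ColourCoding {d n k} {H : Hypergraph d n} (O : GPISE H) (P : KPacking (IsEdge H) k) where
  open GPISE O

  vertices : ∀ j → Enumeration (edge P j) d
  vertices j = subst (Enumeration (edge P j)) (Hypergraph.uniform H _ (valid P j)) (enumerate (edge P j))

  u : Fin k → Fin d → Fin n
  u j = Enumeration.point (vertices j)

  member : ∀ j i → u j i ∈ edge P j
  member j = Enumeration.member (vertices j)

  -- Distinct (edge, position) pairs are distinct vertices, since the edges are disjoint.
  u-injective : ∀ {j i j' i'} → u j i ≡ u j' i' → j ≡ j' × i ≡ i'
  u-injective {j} {i} {j'} {i'} same with j Fin.≟ j'
  ... | yes refl  = refl , Enumeration.injective (vertices j) same
  ... | no  j≢j'  = contradiction (u j i , x∈p∩q⁺ (member j i , subst (_∈ edge P j') (sym same) (member j' i')))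
                                  (disjoint P j≢j')

  w : Fin (k * d) → Fin n
  w a = u (quotient {k} d a) (remainder {k} d a)

  w-combine : ∀ j i → w (combine j i) ≡ u j i
  w-combine j i = cong (λ (j , i) → u j i) (remQuot-combine j i)

  w-injective : Injective _≡_ _≡_ w
  w-injective {a} {b} same with u-injective same
  ... | j≡ , i≡ = begin
    a                                           ≡⟨ combine-remQuot {k} d a ⟨
    combine (quotient {k} d a) (remainder {k} d a)  ≡⟨ cong₂ combine j≡ i≡ ⟩
    combine (quotient {k} d b) (remainder {k} d b)  ≡⟨ combine-remQuot {k} d b ⟩
    b                                           ∎
    where open ≡-Reasoning

  module _ {m} (h : Fin n → Fin m) (h-injective : Injective _≡_ _≡_ (h ∘ w)) where

    colour-injective : ∀ {j i j' i'} → h (u j i) ≡ h (u j' i') → j ≡ j' × i ≡ i'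
    colour-injective {j} {i} {j'} {i'} same =
      combine-injective j i j' i' (h-injective (begin
        h (w (combine j i))    ≡⟨ cong h (w-combine j i) ⟩
        h (u j i)              ≡⟨ same ⟩
        h (u j' i')            ≡⟨ cong h (w-combine j' i') ⟨
        h (w (combine j' i'))  ∎))
      where open ≡-Reasoning

    coloursOf : Fin k → Fin (m ^ d)
    coloursOf j = funToFin (λ i → h (u j i))

    q : Fin k → Query d n
    q j = classQuery h (decode m d (coloursOf j))

    ∈-q⁺ : ∀ j i → u j i ∈ q j i
    ∈-q⁺ j i = ∈-classQuery⁺ h (decode m d (coloursOf j)) (sym (finToFun-funToFin (λ i → h (u j i)) i))

    ∈-q⁻ : ∀ {j i x} → x ∈ q j i → h x ≡ h (u j i)
    ∈-q⁻ {j} {i} x∈ =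
      trans (∈-classQuery⁻ h (decode m d (coloursOf j)) x∈) (finToFun-funToFin (λ i → h (u j i)) i)

    -- The classes are non-empty and, the colours of an edge of P being distinct, disjoint.
    q-valid : ∀ j → ValidQuery (q j)
    q-valid j = (λ i → u j i , ∈-q⁺ j i)
              , λ i i' i≢i' (x , x∈) → let x∈qᵢ , x∈qᵢ' = x∈p∩q⁻ _ _ x∈ in
                  i≢i' (proj₂ (colour-injective (trans (sym (∈-q⁻ x∈qᵢ)) (∈-q⁻ x∈qᵢ'))))

    q-crossed : ∀ j → Crosses (q j) (edge P j)
    q-crossed j = u j , ∈-q⁺ j , λ x → Enumeration.onto (vertices j)
                                     , λ (i , uᵢ≡x) → subst (_∈ edge P j) uᵢ≡x (member j i)

    answer-of : ∀ j → ∃ λ e → answer (q j) ≡ just e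
    answer-of j with answer (q j) in ans
    ... | just e  = e , refl
    ... | nothing = contradiction (q-crossed j) (complete (q j) (q-valid j) ans (edge P j) (valid P j))

    f : Fin k → Subset n
    f j = proj₁ (answer-of j)

    f-colours : ∀ j {x} → x ∈ f j → ∃ λ i → h x ≡ h (u j i)
    f-colours j x∈ with sound (q j) (q-valid j) (f j) (proj₂ (answer-of j))
    ... | _ , v , v∈q , v-onto with proj₁ (v-onto _) x∈
    ...   | i , refl = i , ∈-q⁻ (v∈q i)

    f-disjoint : ∀ {j j'} → j ≢ j' → Disjoint (f j) (f j')
    f-disjoint {j} {j'} j≢j' (x , x∈) with x∈p∩q⁻ (f j) (f j') x∈
    ... | x∈f , x∈f' with f-colours j x∈f | f-colours j' x∈f'
    ...   | i , hx≡ | i' , hx≡' = j≢j' (proj₁ (colour-injective (trans (sym hx≡) hx≡')))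

    found : ∀ qs → (∀ j → q j ∈ₗ qs) → KPacking (Answered (List.map answer qs)) k
    found qs q∈qs = packing f
      (λ j → subst (_∈ₗ List.map answer qs) (proj₂ (answer-of j)) (∈-map⁺ answer (q∈qs j)))
      f-disjoint

module Algorithm (d : ℕ) where

  colours rounds : ℕ → ℕ
  colours k = suc (2 * (k * d * (k * d)))
  rounds  k = suc ⌊log₂ k ⌋

  seeds : ℕ → ℕ → ℕ
  seeds n k = (colours k ^ n) ^ rounds k

  colouring : ∀ n k → Fin (seeds n k) → Fin (rounds k) → Fin n → Fin (colours k)
  colouring n k r t = decode (colours k) n (decode (colours k ^ n) (rounds k) r t)

  roundQuery : ∀ n k → Fin (seeds n k) → Fin (rounds k) × Fin (colours k ^ d) → Query d n
  roundQuery n k r (t , s) = classQuery (colouring n k r t) (decode (colours k) d s)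

  allRoundQueries : ∀ n k → Fin (seeds n k) → List (Query d n)
  allRoundQueries n k r = List.tabulate (roundQuery n k r ∘ Data.Fin.remQuot {rounds k} (colours k ^ d))

  queryList : ∀ n k → Fin (seeds n k) → List (Query d n)
  queryList n k r = List.filter valid? (allRoundQueries n k r)

  algorithm : RandAlg d
  algorithm = record
    { seeds     = seeds
    ; seeds-pos = λ n k → m^n>0 (colours k ^ n) {{m^n≢0 (colours k) n}} (rounds k)
    ; tree      = λ n k r → nonAdaptive (queryList n k r) (decidePacking k)
    }

  queryList-complete : ∀ n k r t s → ValidQuery (roundQuery n k r (t , s)) →
    roundQuery n k r (t , s) ∈ₗ queryList n k r
  queryList-complete n k r t s valid = ∈-filter⁺ valid? asked valid
    where
    asked : roundQuery n k r (t , s) ∈ₗ allRoundQueries n k r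
    asked = subst (_∈ₗ allRoundQueries n k r) (cong (roundQuery n k r) (remQuot-combine t s)) (∈-tabulate⁺ (combine t s))

  queryList-length : ∀ n k r → length (queryList n k r) ≤ rounds k * colours k ^ d
  queryList-length n k r =
    ≤-trans (List.length-filter valid? (allRoundQueries n k r)) (≤-reflexive (List.length-tabulate _))

  module _ {n} (H : Hypergraph d n) (O : GPISE H) (k : ℕ) where
    open GPISE O

    asked-valid : ∀ r → All ValidQuery (queryList n k r)
    asked-valid r = All.all-filter valid? (allRoundQueries n k r)

    -- Every answer received is a hyperedge, since only admissible queries are asked.
    answers-are-edges : ∀ r {e} → Answered (List.map answer (queryList n k r)) e → IsEdge H e
    answers-are-edges r e∈ with ∈-map⁻ answer e∈
    ... | q , q∈ , just≡ = proj₁ (sound q (All.lookup (asked-valid r) q∈) _ (sym just≡))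

    run-solves : ∀ r → ¬ KPacking (IsEdge H) k ⊎ KPacking (Answered (List.map answer (queryList n k r))) k →
      SolvesPacking H k (run answer (RandAlg.tree algorithm n k r))
    run-solves r alternative = subst (SolvesPacking H k) (sym (run-nonAdaptive answer (queryList n k r) (decidePacking k)))
      (decidePacking-correct H k _ (answers-are-edges r) alternative)

    -- All but a 1/k fraction of the seeds lead to a correct run: if a k-packing P exists, a seed
    -- fails only if none of its T colourings is injective on the vertices of P.
    good-seeds : 1 ≤ k → 1 ≤ d →
      Σ (Subset (seeds n k)) λ G → (∀ r → r ∈ G → SolvesPacking H k (run answer (RandAlg.tree algorithm n k r)))
                                 × (seeds n k ∸ ∣ G ∣) * k ≤ seeds n k
    good-seeds 1≤k 1≤d with kPacking? (λ e → Hypergraph.edge H e Bool.≟ true) k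
    ... | no none = ⊤ , (λ r _ → run-solves r (inj₁ none)) , no-failures
      where
      no-failures : (seeds n k ∸ ∣ ⊤ {seeds n k} ∣) * k ≤ seeds n k
      no-failures = subst (λ x → x * k ≤ seeds n k)
        (sym (trans (cong (seeds n k ∸_) (∣⊤∣≡n (seeds n k))) (n∸n≡0 (seeds n k)))) z≤n
    ... | yes P = Vec.tabulate (not ∘ allBad) , solves , count
      where
      open ColourCoding O P
      open Colouring w w-injective
      m T : ℕ
      m = colours k
      T = rounds k

      allBad : Fin (seeds n k) → Bool
      allBad r = allᵇ (bad ∘ colouring n k r)

      solves : ∀ r → r ∈ Vec.tabulate (not ∘ allBad) →
        SolvesPacking H k (run answer (RandAlg.tree algorithm n k r))
      solves r r∈G with allᵇ-false (bad ∘ colouring n k r) (Bool.not-injective (∈-tabulate⁻ r∈G))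
      ... | t , good = run-solves r (inj₂ (found h h-injective (queryList n k r)
            λ j → queryList-complete n k r t (coloursOf h h-injective j) (q-valid h h-injective j)))
        where
        h : Fin n → Fin m
        h = colouring n k r t
        h-injective : Injective _≡_ _≡_ (h ∘ w)
        h-injective = good⇒injective h good

      b : ℕ
      b = ∑[ s < m ^ n ] 𝟙 (bad (decode m n s))

      count : (seeds n k ∸ ∣ Vec.tabulate (not ∘ allBad) ∣) * k ≤ seeds n k
      count = begin
        (seeds n k ∸ ∣ Vec.tabulate (not ∘ allBad) ∣) * k
          ≡⟨ cong (_* k) (∸∣tabulate∣ (not ∘ allBad)) ⟩
        (∑[ r < seeds n k ] 𝟙 (not (not (allBad r)))) * k
          ≡⟨ cong (_* k) (sum-cong-≗ (cong 𝟙 ∘ Bool.not-involutive ∘ allBad)) ⟩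
        (∑[ r < seeds n k ] 𝟙 (allBad r)) * k
          ≡⟨ cong (_* k) (∑-allᵇ T (bad ∘ decode m n)) ⟩
        b ^ T * k
          ≤⟨ amplify {b} T k half (k<2^[1+⌊log₂k⌋] k) ⟩
        seeds n k ∎
        where
        open ≤-Reasoning
        half : b * 2 ≤ m ^ n
        half = half-bad {b = b} (*-mono-≤ 1≤k 1≤d) (bad-count m)

    run-cost : 1 ≤ k → 1 ≤ d → ∀ r →
      ValidRun answer (RandAlg.tree algorithm n k r)
      × queries answer (RandAlg.tree algorithm n k r) ≤ (3 * d * d) ^ d * k ^ (2 * d) * (1 + ⌊log₂ k ⌋)
    run-cost 1≤k 1≤d r = valid-nonAdaptive answer (decidePacking k) (asked-valid r) , (begin
      queries answer (RandAlg.tree algorithm n k r)  ≡⟨ queries-nonAdaptive answer (queryList n k r) (decidePacking k) ⟩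
      length (queryList n k r)                       ≤⟨ queryList-length n k r ⟩
      rounds k * colours k ^ d                       ≤⟨ *-monoʳ-≤ (rounds k) (patterns-bound d k 1≤k 1≤d) ⟩
      rounds k * ((3 * d * d) ^ d * k ^ (2 * d))     ≡⟨ *-comm (rounds k) _ ⟩
      (3 * d * d) ^ d * k ^ (2 * d) * rounds k       ∎)
      where open ≤-Reasoning

-- The failure bound x * k ≤ R, written with the exponents p = q = 1 of the statement.
with-exponents-one : ∀ {x k R} → x * k ≤ R → x ^ 1 * k ^ 1 ≤ R ^ 1
with-exponents-one {x} {k} {R} = subst₂ _≤_ (sym (cong₂ _*_ (*-identityʳ x) (*-identityʳ k))) (sym (*-identityʳ R))

theorem1 : (d : ℕ) → 2 ≤ d →
    Σ (RandAlg d) λ 𝒜 → Σ ℕ λ C → Σ ℕ λ p → Σ ℕ λ q → 1 ≤ p × 1 ≤ q ×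
      ((n k : ℕ) → 1 ≤ k → (H : Hypergraph d n) → (O : GPISE H) →
        ((r : _) → ValidRun (GPISE.answer O) (RandAlg.tree 𝒜 n k r)
                 × queries (GPISE.answer O) (RandAlg.tree 𝒜 n k r) ≤ C * k ^ (2 * d) * (1 + ⌊log₂ k ⌋))
        × Σ (Subset (RandAlg.seeds 𝒜 n k)) λ G →
            ((r : _) → r ∈ G → SolvesPacking H k (run (GPISE.answer O) (RandAlg.tree 𝒜 n k r)))
            × (RandAlg.seeds 𝒜 n k ∸ ∣ G ∣) ^ q * k ^ p ≤ RandAlg.seeds 𝒜 n k ^ q)
theorem1 d 2≤d = algorithm , (3 * d * d) ^ d , 1 , 1 , ≤-refl , ≤-refl , λ n k 1≤k H O →
  let G , solves , few-failures = good-seeds H O k 1≤k 1≤d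
  in run-cost H O k 1≤k 1≤d , G , solves , with-exponents-one {seeds n k ∸ ∣ G ∣} {k} {seeds n k} few-failures
  where
  open Algorithm d
  1≤d : 1 ≤ d
  1≤d = ≤-trans (s≤s z≤n) 2≤d
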